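{- There exist infinitely many pairwise nonequivalent sets $\{a,b,c,d\}$ of four distinct nonzero integers for which there are distinct nonzero perfect squares $n_1 \neq n_2$ such that $\{a,b,c,d\}$ is simultaneously a regular $D(n_1)$-quadruple and a regular $D(n_2)$-quadruple. Moreover, such infinitely many pairwise nonequivalent sets can be chosen so that all four elements $a,b,c,d$ are perfect squares, so that each of these sets is also a $D(0)$-quadruple.
   Context: For an integer $n$, a set of $m$ distinct nonzero integers $\{a_1,\dots,a_m\}$ is called a $D(n)$-$m$-tuple (a $D(n)$-quadruple when $m=4$) if $a_ia_j+n$ is a perfect square (of an integer) for all $1\le i<j\le m$; the case $n=0$ is allowed. A $D(n)$-quadruple $\{a,b,c,d\}$ is called regular if $n(d+c-a-b)^2 = 4(ab+n)(cd+n)$ (this condition is symmetric in $a,b,c,d$). A quadruple $\{a,b,c,d\}$ with the properties $D(n_1)$ and $D(n_2)$ is called equivalent to the quadruple $\{au,bu,cu,du\}$ with the properties $D(n_1u^2)$ and $D(n_2u^2)$, for any nonzero rational $u$. -}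

module Defs where

open import Data.Nat using (ℕ)
open import Data.Integer using (ℤ; _+_; _-_; _*_; +_; 0ℤ)
open import Data.Fin using (Fin; zero; suc)
open import Data.Rational using (ℚ; _/_; 0ℚ) renaming (_*_ to _*ℚ_)
open import Data.Product using (Σ; ∃; _×_; _,_)
open import Relation.Binary.PropositionalEquality using (_≡_; _≢_)
open import Relation.Nullary using (¬_)

IsSquare : ℤ → Set
IsSquare x = ∃ λ (k : ℤ) → x ≡ k * k

NonzeroSquare : ℤ → Set
NonzeroSquare x = (x ≢ 0ℤ) × IsSquare x

-- An ordered presentation (a₁,a₂,a₃,a₄) of a 4-element set of integers
Quad : Set
Quad = Fin 4 → ℤ

a₁ a₂ a₃ a₄ : Quad → ℤ
a₁ q = q zero
a₂ q = q (suc zero)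
a₃ q = q (suc (suc zero))
a₄ q = q (suc (suc (suc zero)))

IsDQuadruple : ℤ → Quad → Set
IsDQuadruple n q =
  (∀ i → q i ≢ 0ℤ) ×
  (∀ i j → i ≢ j → q i ≢ q j) ×
  (∀ i j → i ≢ j → IsSquare (q i * q j + n))

RegularCond : ℤ → Quad → Set
RegularCond n q =
  n * ((a₄ q + a₃ q - a₁ q - a₂ q) * (a₄ q + a₃ q - a₁ q - a₂ q))
    ≡ (+ 4) * ((a₁ q * a₂ q + n) * (a₃ q * a₄ q + n))

IsRegularDQuadruple : ℤ → Quad → Set
IsRegularDQuadruple n q = IsDQuadruple n q × RegularCond n q

toℚ : ℤ → ℚ
toℚ z = z / 1

Equivalent : Quad → Quad → Set
Equivalent q q' = Σ ℚ λ u → (u ≢ 0ℚ) ×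
  (∀ i → ∃ λ j → toℚ (q' i) ≡ u *ℚ toℚ (q j)) ×
  (∀ j → ∃ λ i → toℚ (q' i) ≡ u *ℚ toℚ (q j))

DoublyRegular : Quad → Set
DoublyRegular q = Σ ℤ λ n₁ → Σ ℤ λ n₂ →
  NonzeroSquare n₁ × NonzeroSquare n₂ × (n₁ ≢ n₂) ×
  IsRegularDQuadruple n₁ q × IsRegularDQuadruple n₂ q

-- infinitely many pairwise nonequivalent: a sequence indexed by ℕ, pairwise nonequivalent
PairwiseNonequivalent : (ℕ → Quad) → Set
PairwiseNonequivalent f = ∀ k l → k ≢ l → ¬ Equivalent (f k) (f l)

{-# OPTIONS --safe #-}
module Submission where

open import Defs
open import Data.Nat using (ℕ)
open import Data.Integer using (0ℤ)
open import Data.Product using (Σ; _×_)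

open import Agda.Builtin.FromNat using (Number; fromNat)
open import Agda.Builtin.FromNeg using (Negative)
open import Data.Bool using (Bool; true; false; _∧_; T)
open import Data.Empty using (⊥-elim)
open import Data.Fin using (Fin; zero; suc; #_)
import Data.Fin as Fin
import Data.Fin.Properties as Fin
open import Data.Integer using (ℤ; +_; -[1+_]; _+_; _-_; _*_; -_; _≤_; _<_; +<+)
import Data.Integer as ℤ
import Data.Integer.Literals as ℤLiterals
import Data.Integer.Properties as ℤ
open import Data.Integer.Tactic.RingSolver using (solve-∀)
open import Data.List using (List; []; _∷_)
open import Data.Nat using (zero; suc; s≤s; z≤n)
import Data.Nat as ℕ
import Data.Nat.Literals as ℕLiterals
import Data.Nat.Properties as ℕ
open import Data.Product using (∃; _,_)
import Data.Rational as ℚ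
import Data.Rational.Properties as ℚ
import Data.Rational.Unnormalised as ℚᵘ
import Data.Rational.Unnormalised.Properties as ℚᵘ
open import Data.Sum using (inj₁; inj₂)
open import Data.Unit using (⊤; tt)
open import Function using (_∘_)
open import Relation.Binary using (tri<; tri≈; tri>)
open import Relation.Binary.PropositionalEquality

-- The quadruples are {r₀², r₁², r₂², r₃²} for explicit polynomials rᵢ in t, each a power of t
-- times a polynomial in s = t², with n₁ = ρ₁² and n₂ = ρ₂² for two more such polynomials. That
-- every aᵢaⱼ + nₗ is the square of a polynomial σ, and both regularity conditions, are polynomial
-- identities in t, verified by normalising to coefficient lists; the inequalities needed hold for
-- t ≥ 4 because the relevant differences, re-expanded around t = 4, have nonnegative coefficients.
-- Equivalent quadruples of positive integers have the same ratio max/min, and along the family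
-- this ratio strictly increases with t, so distinct members are nonequivalent.

-- Overloaded literals are only enabled while fromNat is in scope.
instance
  ℕ-number : Number ℕ
  ℕ-number = ℕLiterals.number

  ℤ-number : Number ℤ
  ℤ-number = ℤLiterals.number

  ℤ-negative : Negative ℤ
  ℤ-negative = ℤLiterals.negative

-- Integer polynomials and a certified normaliser

Poly : Set
Poly = List ℤ

infixl 6 _+ᴾ_
infixl 7 _*ᴾ_ _·ᴾ_

_+ᴾ_ : Poly → Poly → Poly
[]      +ᴾ q       = q
(a ∷ p) +ᴾ []      = a ∷ p
(a ∷ p) +ᴾ (b ∷ q) = a + b ∷ p +ᴾ q

_·ᴾ_ : ℤ → Poly → Poly
c ·ᴾ []      = []
c ·ᴾ (a ∷ p) = c * a ∷ c ·ᴾ p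

_*ᴾ_ : Poly → Poly → Poly
[]      *ᴾ q = []
(a ∷ p) *ᴾ q = a ·ᴾ q +ᴾ (0ℤ ∷ p *ᴾ q)

eval : Poly → ℤ → ℤ
eval []      v = 0ℤ
eval (a ∷ p) v = a + v * eval p v

module _ where
  open ≡-Reasoning

  eval-+ᴾ : ∀ p q v → eval (p +ᴾ q) v ≡ eval p v + eval q v
  eval-+ᴾ []      q       v = sym (ℤ.+-identityˡ (eval q v))
  eval-+ᴾ (a ∷ p) []      v = sym (ℤ.+-identityʳ (eval (a ∷ p) v))
  eval-+ᴾ (a ∷ p) (b ∷ q) v = begin
    a + b + v * eval (p +ᴾ q) v         ≡⟨ cong (λ w → a + b + v * w) (eval-+ᴾ p q v) ⟩
    a + b + v * (eval p v + eval q v)   ≡⟨ ring a b v (eval p v) (eval q v) ⟩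
    a + v * eval p v + (b + v * eval q v) ∎
    where
    ring : ∀ a b v y z → a + b + v * (y + z) ≡ a + v * y + (b + v * z)
    ring = solve-∀

  eval-·ᴾ : ∀ c p v → eval (c ·ᴾ p) v ≡ c * eval p v
  eval-·ᴾ c []      v = sym (ℤ.*-zeroʳ c)
  eval-·ᴾ c (a ∷ p) v = begin
    c * a + v * eval (c ·ᴾ p) v  ≡⟨ cong (λ w → c * a + v * w) (eval-·ᴾ c p v) ⟩
    c * a + v * (c * eval p v)   ≡⟨ ring c a v (eval p v) ⟩
    c * (a + v * eval p v)       ∎
    where
    ring : ∀ c a v y → c * a + v * (c * y) ≡ c * (a + v * y)
    ring = solve-∀

  eval-*ᴾ : ∀ p q v → eval (p *ᴾ q) v ≡ eval p v * eval q v
  eval-*ᴾ []      q v = sym (ℤ.*-zeroˡ (eval q v))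
  eval-*ᴾ (a ∷ p) q v = begin
    eval (a ·ᴾ q +ᴾ (0ℤ ∷ p *ᴾ q)) v                  ≡⟨ eval-+ᴾ (a ·ᴾ q) (0ℤ ∷ p *ᴾ q) v ⟩
    eval (a ·ᴾ q) v + (0ℤ + v * eval (p *ᴾ q) v)      ≡⟨ cong₂ (λ y z → y + (0ℤ + v * z))
                                                               (eval-·ᴾ a q v) (eval-*ᴾ p q v) ⟩
    a * eval q v + (0ℤ + v * (eval p v * eval q v))   ≡⟨ ring a v (eval p v) (eval q v) ⟩
    (a + v * eval p v) * eval q v                     ∎
    where
    ring : ∀ a v y z → a * z + (0ℤ + v * (y * z)) ≡ (a + v * y) * z
    ring = solve-∀

isZero : Poly → Bool
isZero []              = true
isZero (+ zero ∷ p)    = isZero p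
isZero (+ suc _ ∷ _)   = false
isZero (-[1+ _ ] ∷ _)  = false

eval-isZero : ∀ p v → T (isZero p) → eval p v ≡ 0ℤ
eval-isZero []           v _ = refl
eval-isZero (+ zero ∷ p) v z rewrite eval-isZero p v z | ℤ.*-zeroʳ v = refl

isNonNeg : ℤ → Bool
isNonNeg (+ _)     = true
isNonNeg -[1+ _ ]  = false

allNonNeg : Poly → Bool
allNonNeg []      = true
allNonNeg (a ∷ p) = isNonNeg a ∧ allNonNeg p

isPositive : Poly → Bool
isPositive (+ suc _ ∷ p) = allNonNeg p
isPositive _             = false

eval-allNonNeg : ∀ p k → T (allNonNeg p) → ∃ λ m → eval p (+ k) ≡ + m
eval-allNonNeg []        k _ = 0 , refl
eval-allNonNeg (+ a ∷ p) k h with eval-allNonNeg p k h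
... | m , eq = a ℕ.+ k ℕ.* m , trans (cong (λ w → + a + + k * w) eq)
                                      (cong (λ w → + a + w) (sym (ℤ.pos-* k m)))

eval-isPositive : ∀ p k → T (isPositive p) → 0ℤ < eval p (+ k)
eval-isPositive (+ suc a ∷ p) k h with eval-allNonNeg p k h
... | m , eq rewrite eq | sym (ℤ.pos-* k m) = +<+ (s≤s z≤n)

infixl 6 _:+_ _:-_
infixl 7 _:*_
infixr 8 _:^_

data Expr : Set where
  con        : ℤ → Expr
  x          : Expr
  _:+_ _:-_ _:*_ : Expr → Expr → Expr

instance
  Expr-number : Number Expr
  Expr-number = record { Constraint = λ _ → ⊤ ; fromNat = λ n → con (+ n) }

  Expr-negative : Negative Expr
  Expr-negative = record { Constraint = λ _ → ⊤ ; fromNeg = λ n → con (- + n) }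

_:^_ : Expr → ℕ → Expr
e :^ zero  = 1
e :^ suc n = e :* e :^ n

horner : List ℤ → Expr → Expr
horner []       e = 0
horner (c ∷ cs) e = con c :+ e :* horner cs e

⟦_⟧ : Expr → ℤ → ℤ
⟦ con c ⟧    v = c
⟦ x ⟧        v = v
⟦ e :+ f ⟧   v = ⟦ e ⟧ v + ⟦ f ⟧ v
⟦ e :- f ⟧   v = ⟦ e ⟧ v - ⟦ f ⟧ v
⟦ e :* f ⟧   v = ⟦ e ⟧ v * ⟦ f ⟧ v

_[x≔_] : Expr → Expr → Expr
con c [x≔ f ]    = con c
x [x≔ f ]        = f
(e :+ g) [x≔ f ] = e [x≔ f ] :+ g [x≔ f ]
(e :- g) [x≔ f ] = e [x≔ f ] :- g [x≔ f ]
(e :* g) [x≔ f ] = e [x≔ f ] :* g [x≔ f ]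

⟦⟧-[x≔] : ∀ e f v → ⟦ e [x≔ f ] ⟧ v ≡ ⟦ e ⟧ (⟦ f ⟧ v)
⟦⟧-[x≔] (con c)  f v = refl
⟦⟧-[x≔] x        f v = refl
⟦⟧-[x≔] (e :+ g) f v = cong₂ _+_ (⟦⟧-[x≔] e f v) (⟦⟧-[x≔] g f v)
⟦⟧-[x≔] (e :- g) f v = cong₂ _-_ (⟦⟧-[x≔] e f v) (⟦⟧-[x≔] g f v)
⟦⟧-[x≔] (e :* g) f v = cong₂ _*_ (⟦⟧-[x≔] e f v) (⟦⟧-[x≔] g f v)

normalise : Expr → Poly
normalise (con c)  = c ∷ []
normalise x        = 0ℤ ∷ 1 ∷ []
normalise (e :+ f) = normalise e +ᴾ normalise f
normalise (e :- f) = normalise e +ᴾ -1 ·ᴾ normalise f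
normalise (e :* f) = normalise e *ᴾ normalise f

eval-normalise : ∀ e v → eval (normalise e) v ≡ ⟦ e ⟧ v
eval-normalise (con c)  v = trans (cong (λ w → c + w) (ℤ.*-zeroʳ v)) (ℤ.+-identityʳ c)
eval-normalise x        v = ring v
  where
  ring : ∀ v → 0ℤ + v * (1 + v * 0ℤ) ≡ v
  ring = solve-∀
eval-normalise (e :+ f) v = trans (eval-+ᴾ (normalise e) (normalise f) v)
                                  (cong₂ _+_ (eval-normalise e v) (eval-normalise f v))
eval-normalise (e :- f) v = trans (eval-+ᴾ (normalise e) (-1 ·ᴾ normalise f) v)
                                  (cong₂ _+_ (eval-normalise e v) negate)
  where
  negate : eval (-1 ·ᴾ normalise f) v ≡ - ⟦ f ⟧ v
  negate = trans (eval-·ᴾ -1 (normalise f) v) (trans (ℤ.-1*i≡-i _) (cong -_ (eval-normalise f v)))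
eval-normalise (e :* f) v = trans (eval-*ᴾ (normalise e) (normalise f) v)
                                  (cong₂ _*_ (eval-normalise e v) (eval-normalise f v))

infix 4 _≡ᴺ_ _<ᴺ_

_≡ᴺ_ : Expr → Expr → Set
e ≡ᴺ f = T (isZero (normalise (e :- f)))

_<ᴺ_ : Expr → Expr → Set
e <ᴺ f = T (isPositive (normalise (f :- e)))

≡ᴺ⇒≡ : ∀ e f → e ≡ᴺ f → ∀ v → ⟦ e ⟧ v ≡ ⟦ f ⟧ v
≡ᴺ⇒≡ e f h v =
  ℤ.i-j≡0⇒i≡j _ _ (trans (sym (eval-normalise (e :- f) v)) (eval-isZero (normalise (e :- f)) v h))

<ᴺ⇒< : ∀ e f → e <ᴺ f → ∀ k → ⟦ e ⟧ (+ k) < ⟦ f ⟧ (+ k)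
<ᴺ⇒< e f h k =
  subst₂ _<_ (ℤ.+-identityˡ _) (ring (⟦ f ⟧ (+ k)) (⟦ e ⟧ (+ k)))
         (ℤ.+-monoˡ-< (⟦ e ⟧ (+ k)) 0<f-e)
  where
  0<f-e : 0ℤ < ⟦ f :- e ⟧ (+ k)
  0<f-e = subst (0ℤ <_) (eval-normalise (f :- e) (+ k)) (eval-isPositive (normalise (f :- e)) k h)
  ring : ∀ a b → a - b + b ≡ a
  ring = solve-∀

-- Increasing quadruples

record Increasing (q : Quad) : Set where
  constructor increasing
  field
    0<a₁  : 0ℤ < a₁ q
    a₁<a₂ : a₁ q < a₂ q
    a₂<a₃ : a₂ q < a₃ q
    a₃<a₄ : a₃ q < a₄ q

All<Pairs : (Fin 4 → Fin 4 → Set) → Set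
All<Pairs P = P (# 0) (# 1) × P (# 0) (# 2) × P (# 0) (# 3)
            × P (# 1) (# 2) × P (# 1) (# 3) × P (# 2) (# 3)

all<Pairs : ∀ {P} → All<Pairs P → ∀ {i j} → i Fin.< j → P i j
all<Pairs (p₀₁ , _ , _ , _ , _ , _) {zero} {suc zero} _ = p₀₁
all<Pairs (_ , p₀₂ , _ , _ , _ , _) {zero} {suc (suc zero)} _ = p₀₂
all<Pairs (_ , _ , p₀₃ , _ , _ , _) {zero} {suc (suc (suc zero))} _ = p₀₃
all<Pairs (_ , _ , _ , p₁₂ , _ , _) {suc zero} {suc (suc zero)} _ = p₁₂
all<Pairs (_ , _ , _ , _ , p₁₃ , _) {suc zero} {suc (suc (suc zero))} _ = p₁₃
all<Pairs (_ , _ , _ , _ , _ , p₂₃) {suc (suc zero)} {suc (suc (suc zero))} _ = p₂₃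
all<Pairs _ {_} {zero} ()
all<Pairs _ {suc _} {suc zero} (s≤s ())
all<Pairs _ {suc (suc _)} {suc (suc zero)} (s≤s (s≤s ()))
all<Pairs _ {suc (suc (suc _))} {suc (suc (suc zero))} (s≤s (s≤s (s≤s ())))

tabulate<Pairs : ∀ {P} → (∀ i j → P i j) → All<Pairs P
tabulate<Pairs p = p _ _ , p _ _ , p _ _ , p _ _ , p _ _ , p _ _

map<Pairs : ∀ {P Q} → (∀ {i j} → P i j → Q i j) → All<Pairs P → All<Pairs Q
map<Pairs f (p₀₁ , p₀₂ , p₀₃ , p₁₂ , p₁₃ , p₂₃) = f p₀₁ , f p₀₂ , f p₀₃ , f p₁₂ , f p₁₃ , f p₂₃

onDistinctPairs : ∀ {n} (P : Fin n → Fin n → Set) → (∀ {i j} → P i j → P j i) →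
                  (∀ {i j} → i Fin.< j → P i j) → ∀ i j → i ≢ j → P i j
onDistinctPairs P sym-P P< i j i≢j with Fin.<-cmp i j
... | tri< i<j _ _ = P< i<j
... | tri≈ _ i≡j _ = ⊥-elim (i≢j i≡j)
... | tri> _ _ j<i = sym-P (P< j<i)

module _ {q : Quad} (inc : Increasing q) where
  open Increasing inc

  increasing⇒< : ∀ {i j} → i Fin.< j → q i < q j
  increasing⇒< = all<Pairs {λ i j → q i < q j}
    (a₁<a₂ , ℤ.<-trans a₁<a₂ a₂<a₃ , ℤ.<-trans a₁<a₂ a₂<a₄ , a₂<a₃ , a₂<a₄ , a₃<a₄)
    where a₂<a₄ = ℤ.<-trans a₂<a₃ a₃<a₄

  increasing⇒min≤ : ∀ i → a₁ q ≤ q i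
  increasing⇒min≤ zero    = ℤ.≤-refl
  increasing⇒min≤ (suc i) = ℤ.<⇒≤ (increasing⇒< (s≤s z≤n))

  increasing⇒≤max : ∀ i → q i ≤ a₄ q
  increasing⇒≤max zero                   = ℤ.<⇒≤ (increasing⇒< (s≤s z≤n))
  increasing⇒≤max (suc zero)             = ℤ.<⇒≤ (increasing⇒< (s≤s (s≤s z≤n)))
  increasing⇒≤max (suc (suc zero))       = ℤ.<⇒≤ (increasing⇒< (s≤s (s≤s (s≤s z≤n))))
  increasing⇒≤max (suc (suc (suc zero))) = ℤ.≤-refl

  increasing⇒0< : ∀ i → 0ℤ < q i
  increasing⇒0< i = ℤ.<-≤-trans 0<a₁ (increasing⇒min≤ i)

  increasing⇒IsDQuadruple : ∀ {n} → All<Pairs (λ i j → IsSquare (q i * q j + n)) → IsDQuadruple n q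
  increasing⇒IsDQuadruple {n} squares =
      (λ i → ℤ.<⇒≢ (increasing⇒0< i) ∘ sym)
    , onDistinctPairs (λ i j → q i ≢ q j) (λ ne → ne ∘ sym) (λ i<j → ℤ.<⇒≢ (increasing⇒< i<j))
    , onDistinctPairs (λ i j → IsSquare (q i * q j + n))
                      (λ {i} {j} → subst (λ m → IsSquare (m + n)) (ℤ.*-comm (q i) (q j)))
                      (all<Pairs {λ i j → IsSquare (q i * q j + n)} squares)

square*square : ∀ {a b} → IsSquare a → IsSquare b → IsSquare (a * b + 0ℤ)
square*square (m , refl) (n , refl) = m * n , ring m n
  where
  ring : ∀ m n → m * m * (n * n) + 0ℤ ≡ m * n * (m * n)
  ring = solve-∀

squares⇒IsDQuadruple₀ : ∀ {q} → Increasing q → (∀ i → IsSquare (q i)) → IsDQuadruple 0ℤ q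
squares⇒IsDQuadruple₀ inc squares =
  increasing⇒IsDQuadruple inc (tabulate<Pairs λ i j → square*square (squares i) (squares j))

0<⇒NonzeroSquare : ∀ m → 0ℤ < m * m → NonzeroSquare (m * m)
0<⇒NonzeroSquare m 0<m² = ℤ.<⇒≢ 0<m² ∘ sym , m , refl

-- The ratio max/min is an equivalence invariant

toℚᵘ-toℚ : ∀ a → ℚ.toℚᵘ (toℚ a) ℚᵘ.≃ ℚᵘ.mkℚᵘ a 0
toℚᵘ-toℚ a = ℚ.fromℚᵘ-injective (ℚ.fromℚᵘ-toℚᵘ (toℚ a))

toℚ-*-injective : ∀ a b c d → toℚ a ℚ.* toℚ b ≡ toℚ c ℚ.* toℚ d → a * b ≡ c * d
toℚ-*-injective a b c d eq =
  unwrap (ℚᵘ.≃-trans (ℚᵘ.≃-sym (toℚᵘ-* a b))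
                     (ℚᵘ.≃-trans (ℚᵘ.≃-reflexive (cong ℚ.toℚᵘ eq)) (toℚᵘ-* c d)))
  where
  toℚᵘ-* : ∀ a b → ℚ.toℚᵘ (toℚ a ℚ.* toℚ b) ℚᵘ.≃ ℚᵘ.mkℚᵘ a 0 ℚᵘ.* ℚᵘ.mkℚᵘ b 0
  toℚᵘ-* a b = ℚᵘ.≃-trans (ℚ.toℚᵘ-homo-* (toℚ a) (toℚ b)) (ℚᵘ.*-cong (toℚᵘ-toℚ a) (toℚᵘ-toℚ b))
  unwrap : ℚᵘ.mkℚᵘ a 0 ℚᵘ.* ℚᵘ.mkℚᵘ b 0 ℚᵘ.≃ ℚᵘ.mkℚᵘ c 0 ℚᵘ.* ℚᵘ.mkℚᵘ d 0 → a * b ≡ c * d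
  unwrap (ℚᵘ.*≡* eq′) = trans (sym (ℤ.*-identityʳ (a * b))) (trans eq′ (ℤ.*-identityʳ (c * d)))

toℚ-cross : ∀ a b c d u → toℚ a ≡ u ℚ.* toℚ b → toℚ c ≡ u ℚ.* toℚ d → a * d ≡ c * b
toℚ-cross a b c d u a≡ub c≡ud = toℚ-*-injective a d c b (begin
  toℚ a ℚ.* toℚ d            ≡⟨ cong (ℚ._* toℚ d) a≡ub ⟩
  u ℚ.* toℚ b ℚ.* toℚ d      ≡⟨ ℚ.*-assoc u (toℚ b) (toℚ d) ⟩
  u ℚ.* (toℚ b ℚ.* toℚ d)    ≡⟨ cong (u ℚ.*_) (ℚ.*-comm (toℚ b) (toℚ d)) ⟩
  u ℚ.* (toℚ d ℚ.* toℚ b)    ≡⟨ ℚ.*-assoc u (toℚ d) (toℚ b) ⟨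
  u ℚ.* toℚ d ℚ.* toℚ b      ≡⟨ cong (ℚ._* toℚ b) c≡ud ⟨
  toℚ c ℚ.* toℚ b            ∎)
  where open ≡-Reasoning

equivalent⇒max/min≡ : ∀ {q q′} → Increasing q → Increasing q′ → Equivalent q q′ →
                      a₄ q′ * a₁ q ≡ a₄ q * a₁ q′
equivalent⇒max/min≡ {q} {q′} inc inc′ (u , _ , fwd , bwd)
  with fwd (# 0) | fwd (# 3) | bwd (# 0) | bwd (# 3)
... | j₁ , q′₁≡uqj₁ | j₄ , q′₄≡uqj₄ | i₁ , q′i₁≡uq₁ | i₄ , q′i₄≡uq₄ = ℤ.≤-antisym ≤₁ ≤₂
  where
  open ℤ.≤-Reasoning
  0≤ : ∀ {q} → Increasing q → ∀ i → 0ℤ ≤ q i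
  0≤ inc i = ℤ.<⇒≤ (increasing⇒0< inc i)
  *-monoˡ : ∀ {c a b} → 0ℤ ≤ c → a ≤ b → c * a ≤ c * b
  *-monoˡ {c} 0≤c = ℤ.*-monoˡ-≤-nonNeg c {{ℤ.nonNegative 0≤c}}
  *-monoʳ : ∀ {c a b} → 0ℤ ≤ c → a ≤ b → a * c ≤ b * c
  *-monoʳ {c} 0≤c = ℤ.*-monoʳ-≤-nonNeg c {{ℤ.nonNegative 0≤c}}
  ≤₁ : a₄ q′ * a₁ q ≤ a₄ q * a₁ q′
  ≤₁ = begin
    a₄ q′ * a₁ q     ≤⟨ *-monoˡ (0≤ inc′ (# 3)) (increasing⇒min≤ inc j₁) ⟩
    a₄ q′ * q j₁     ≡⟨ toℚ-cross (a₁ q′) (q j₁) (a₄ q′) (q j₄) u q′₁≡uqj₁ q′₄≡uqj₄ ⟨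
    a₁ q′ * q j₄     ≤⟨ *-monoˡ (0≤ inc′ (# 0)) (increasing⇒≤max inc j₄) ⟩
    a₁ q′ * a₄ q     ≡⟨ ℤ.*-comm (a₁ q′) (a₄ q) ⟩
    a₄ q * a₁ q′     ∎
  ≤₂ : a₄ q * a₁ q′ ≤ a₄ q′ * a₁ q
  ≤₂ = begin
    a₄ q * a₁ q′     ≡⟨ ℤ.*-comm (a₄ q) (a₁ q′) ⟩
    a₁ q′ * a₄ q     ≤⟨ *-monoʳ (0≤ inc (# 3)) (increasing⇒min≤ inc′ i₁) ⟩
    q′ i₁ * a₄ q     ≡⟨ toℚ-cross (q′ i₁) (a₁ q) (q′ i₄) (a₄ q) u q′i₁≡uq₁ q′i₄≡uq₄ ⟩
    q′ i₄ * a₁ q     ≤⟨ *-monoʳ (0≤ inc (# 0)) (increasing⇒≤max inc′ i₄) ⟩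
    a₄ q′ * a₁ q     ∎

cross-<-trans : ∀ {a₁ a₂ a₃ b₁ b₂ b₃} → 0ℤ < b₁ → 0ℤ < b₂ → 0ℤ < b₃ →
                a₁ * b₂ < a₂ * b₁ → a₂ * b₃ < a₃ * b₂ → a₁ * b₃ < a₃ * b₁
cross-<-trans {a₁} {a₂} {a₃} {b₁} {b₂} {b₃} 0<b₁ 0<b₂ 0<b₃ lt₁₂ lt₂₃ =
  ℤ.*-cancelˡ-<-nonNeg b₂ {{ℤ.nonNegative (ℤ.<⇒≤ 0<b₂)}} (begin-strict
    b₂ * (a₁ * b₃)    ≡⟨ ring₁ b₂ a₁ b₃ ⟩
    a₁ * b₂ * b₃      <⟨ ℤ.*-monoʳ-<-pos b₃ {{ℤ.positive 0<b₃}} lt₁₂ ⟩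
    a₂ * b₁ * b₃      ≡⟨ ring₂ a₂ b₁ b₃ ⟩
    a₂ * b₃ * b₁      <⟨ ℤ.*-monoʳ-<-pos b₁ {{ℤ.positive 0<b₁}} lt₂₃ ⟩
    a₃ * b₂ * b₁      ≡⟨ ring₃ a₃ b₂ b₁ ⟩
    b₂ * (a₃ * b₁)    ∎)
  where
  open ℤ.≤-Reasoning
  ring₁ : ∀ b a c → b * (a * c) ≡ a * b * c
  ring₁ = solve-∀
  ring₂ : ∀ a b c → a * b * c ≡ a * c * b
  ring₂ = solve-∀
  ring₃ : ∀ a b c → a * b * c ≡ b * (a * c)
  ring₃ = solve-∀

infix 4 _≺_
_≺_ : Quad → Quad → Set
q ≺ q′ = a₄ q * a₁ q′ < a₄ q′ * a₁ q

≺-trans : ∀ {q₁ q₂ q₃} → Increasing q₁ → Increasing q₂ → Increasing q₃ →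
          q₁ ≺ q₂ → q₂ ≺ q₃ → q₁ ≺ q₃
≺-trans {q₁} {q₂} {q₃} inc₁ inc₂ inc₃ =
  cross-<-trans {a₄ q₁} {a₄ q₂} {a₄ q₃}
                (Increasing.0<a₁ inc₁) (Increasing.0<a₁ inc₂) (Increasing.0<a₁ inc₃)

module _ {f : ℕ → Quad} (inc : ∀ k → Increasing (f k)) (step : ∀ k → f k ≺ f (suc k)) where

  ≺-chain : ∀ {k l} → k ℕ.< l → f k ≺ f l
  ≺-chain {k} {suc l} k<1+l with ℕ.m<1+n⇒m<n∨m≡n k<1+l
  ... | inj₁ k<l  = ≺-trans (inc k) (inc l) (inc (suc l)) (≺-chain k<l) (step l)
  ... | inj₂ refl = step k

  ≺-chain⇒pairwiseNonequivalent : PairwiseNonequivalent f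
  ≺-chain⇒pairwiseNonequivalent k l k≢l f≈ with ℕ.<-cmp k l
  ... | tri< k<l _ _ = ℤ.<-irrefl (sym (equivalent⇒max/min≡ (inc k) (inc l) f≈)) (≺-chain k<l)
  ... | tri≈ _ k≡l _ = k≢l k≡l
  ... | tri> _ _ l<k = ℤ.<-irrefl (equivalent⇒max/min≡ (inc k) (inc l) f≈) (≺-chain l<k)

-- The family

s : Expr
s = x :* x

r : Fin 4 → Expr
r zero                   = 2 :* x :* horner (1 ∷ -2 ∷ -5 ∷ -2 ∷ 1 ∷ []) s
r (suc zero)             = 2 :* x :* horner (1 ∷ 0 ∷ -3 ∷ 0 ∷ 1 ∷ []) s
r (suc (suc zero))       = 4 :* x :* horner (-1 ∷ -1 ∷ 0 ∷ 1 ∷ 1 ∷ []) s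
r (suc (suc (suc zero))) = 2 :* horner (1 ∷ 3 ∷ 1 ∷ 1 ∷ 3 ∷ 1 ∷ []) s

A : Fin 4 → Expr
A i = r i :* r i

ρ₁ ρ₂ ν₁ ν₂ : Expr
ρ₁ = 16 :* x :^ 3 :* horner (1 ∷ 2 ∷ -1 ∷ -5 ∷ -5 ∷ -1 ∷ 2 ∷ 1 ∷ []) s
ρ₂ = 2 :* horner (-1 ∷ 0 ∷ 11 ∷ 8 ∷ -9 ∷ 0 ∷ 9 ∷ -8 ∷ -11 ∷ 0 ∷ 1 ∷ []) s
ν₁ = ρ₁ :* ρ₁
ν₂ = ρ₂ :* ρ₂

-- Opaque so that ⟦ e ⟧ (t k) cannot unfold into huge ℕ-arithmetic terms during conversion checking.
-- The offset 4 is the least one for which all positivity certificates below hold.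
opaque
  t : ℕ → ℤ
  t k = + (4 ℕ.+ k)

  t-def : ∀ k → t k ≡ + (4 ℕ.+ k)
  t-def k = refl

family : ℕ → Quad
family k i = ⟦ A i ⟧ (t k)

shift₄ : Expr → Expr
shift₄ e = e [x≔ 4 :+ x ]

<-at-t : ∀ e f → shift₄ e <ᴺ shift₄ f → ∀ k → ⟦ e ⟧ (t k) < ⟦ f ⟧ (t k)
<-at-t e f h k = subst (λ v → ⟦ e ⟧ v < ⟦ f ⟧ v) (sym (t-def k))
  (subst₂ _<_ (⟦⟧-[x≔] e (4 :+ x) (+ k)) (⟦⟧-[x≔] f (4 :+ x) (+ k))
              (<ᴺ⇒< (shift₄ e) (shift₄ f) h k))

next : Expr → Expr
next e = e [x≔ 1 :+ x ]

⟦next⟧ : ∀ e k → ⟦ next e ⟧ (t k) ≡ ⟦ e ⟧ (t (suc k))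
⟦next⟧ e k = trans (⟦⟧-[x≔] e (1 :+ x) (t k))
                   (cong ⟦ e ⟧ (trans (cong (λ v → 1 + v) (t-def k)) (sym (t-def (suc k)))))

family-increasing : ∀ k → Increasing (family k)
family-increasing k = increasing (<-at-t 0 (A (# 0)) tt k) (<-at-t (A (# 0)) (A (# 1)) tt k)
                                 (<-at-t (A (# 1)) (A (# 2)) tt k) (<-at-t (A (# 2)) (A (# 3)) tt k)

family-≺-suc : ∀ k → family k ≺ family (suc k)
family-≺-suc k =
  subst₂ _<_ (cong (⟦ A (# 3) ⟧ (t k) *_) (⟦next⟧ (A (# 0)) k))
             (cong (_* ⟦ A (# 0) ⟧ (t k)) (⟦next⟧ (A (# 3)) k))
         (<-at-t (A (# 3) :* next (A (# 0))) (next (A (# 3)) :* A (# 0)) tt k)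

RootCertificate : Expr → Fin 4 → Fin 4 → Set
RootCertificate ν i j = ∃ λ σ → A i :* A j :+ ν ≡ᴺ σ :* σ

pairRoots₁ : All<Pairs (RootCertificate ν₁)
pairRoots₁ =
    (4 :* s :* horner (1 ∷ 6 ∷ 8 ∷ -12 ∷ -31 ∷ -12 ∷ 8 ∷ 6 ∷ 1 ∷ []) s , tt)
  , (8 :* s :* horner (1 ∷ 1 ∷ 1 ∷ 2 ∷ 2 ∷ 2 ∷ 1 ∷ 1 ∷ 1 ∷ []) s , tt)
  , (4 :* x :* horner (1 ∷ 1 ∷ -2 ∷ 6 ∷ 31 ∷ 31 ∷ 6 ∷ -2 ∷ 1 ∷ 1 ∷ []) s , tt)
  , (8 :* s :* horner (1 ∷ 3 ∷ 1 ∷ -6 ∷ -10 ∷ -6 ∷ 1 ∷ 3 ∷ 1 ∷ []) s , tt)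
  , (4 :* x :* horner (1 ∷ 3 ∷ 6 ∷ 0 ∷ -23 ∷ -23 ∷ 0 ∷ 6 ∷ 3 ∷ 1 ∷ []) s , tt)
  , (8 :* x :* horner (1 ∷ 4 ∷ 6 ∷ 1 ∷ -6 ∷ -6 ∷ 1 ∷ 6 ∷ 4 ∷ 1 ∷ []) s , tt)

pairRoots₂ : All<Pairs (RootCertificate ν₂)
pairRoots₂ =
    (2 :* horner (1 ∷ 0 ∷ -9 ∷ -16 ∷ 5 ∷ 24 ∷ 5 ∷ -16 ∷ -9 ∷ 0 ∷ 1 ∷ []) s , tt)
  , (2 :* horner (-1 ∷ 0 ∷ 3 ∷ 24 ∷ 39 ∷ 0 ∷ -39 ∷ -24 ∷ -3 ∷ 0 ∷ 1 ∷ []) s , tt)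
  , (2 :* horner (1 ∷ 2 ∷ -9 ∷ -28 ∷ -27 ∷ -18 ∷ -27 ∷ -28 ∷ -9 ∷ 2 ∷ 1 ∷ []) s , tt)
  , (2 :* horner (-1 ∷ 0 ∷ 3 ∷ -8 ∷ -25 ∷ 0 ∷ 25 ∷ 8 ∷ -3 ∷ 0 ∷ 1 ∷ []) s , tt)
  , (2 :* horner (1 ∷ 2 ∷ -1 ∷ 4 ∷ 5 ∷ -2 ∷ 5 ∷ 4 ∷ -1 ∷ 2 ∷ 1 ∷ []) s , tt)
  , (2 :* horner (-1 ∷ -8 ∷ -21 ∷ -16 ∷ 7 ∷ 0 ∷ -7 ∷ 16 ∷ 21 ∷ 8 ∷ 1 ∷ []) s , tt)

regularityˡ regularityʳ : Expr → Expr
regularityˡ ν = ν :* (d :* d)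
  where d = A (# 3) :+ A (# 2) :- A (# 0) :- A (# 1)
regularityʳ ν = 4 :* ((A (# 0) :* A (# 1) :+ ν) :* (A (# 2) :* A (# 3) :+ ν))

family-IsRegularDQuadruple : ∀ ν → All<Pairs (RootCertificate ν) → regularityˡ ν ≡ᴺ regularityʳ ν →
                             ∀ k → IsRegularDQuadruple (⟦ ν ⟧ (t k)) (family k)
family-IsRegularDQuadruple ν roots regular k =
    increasing⇒IsDQuadruple (family-increasing k)
      (map<Pairs {RootCertificate ν} {λ i j → IsSquare (family k i * family k j + ⟦ ν ⟧ (t k))}
                 (λ {i} {j} (σ , h) → ⟦ σ ⟧ (t k) , ≡ᴺ⇒≡ (A i :* A j :+ ν) (σ :* σ) h (t k)) roots)
  , ≡ᴺ⇒≡ (regularityˡ ν) (regularityʳ ν) regular (t k)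

family-doubly-regular : ∀ k → DoublyRegular (family k)
family-doubly-regular k =
    ⟦ ν₁ ⟧ (t k) , ⟦ ν₂ ⟧ (t k)
  , 0<⇒NonzeroSquare (⟦ ρ₁ ⟧ (t k)) (<-at-t 0 ν₁ tt k)
  , 0<⇒NonzeroSquare (⟦ ρ₂ ⟧ (t k)) (<-at-t 0 ν₂ tt k)
  , ℤ.<⇒≢ (<-at-t ν₁ ν₂ tt k)
  , family-IsRegularDQuadruple ν₁ pairRoots₁ tt k
  , family-IsRegularDQuadruple ν₂ pairRoots₂ tt k

family-squares : ∀ k i → IsSquare (family k i)
family-squares k i = ⟦ r i ⟧ (t k) , refl

theorem1 : (Σ (ℕ → Quad) λ f → (∀ k → DoublyRegular (f k)) × PairwiseNonequivalent f)
    × (Σ (ℕ → Quad) λ f →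
         (∀ k → DoublyRegular (f k) × (∀ i → IsSquare (f k i)) × IsDQuadruple 0ℤ (f k))
         × PairwiseNonequivalent f)
theorem1 =
    (family , family-doubly-regular , nonequivalent)
  , (family , (λ k → family-doubly-regular k , family-squares k ,
                     squares⇒IsDQuadruple₀ (family-increasing k) (family-squares k))
            , nonequivalent)
  where
  nonequivalent : PairwiseNonequivalent family
  nonequivalent = ≺-chain⇒pairwiseNonequivalent family-increasing family-≺-suc
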